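{- Let $h\ge1$ and $1\le m\le h$. For each divisor $d>1$ of $h$ and each integer $j$, put $$L_{d,j}=\sum_{\substack{1\le k\le d-1\\ \gcd(k,d)=1}}\frac{\zeta_d^{k(j-1)}}{1-\zeta_d^{k}},\qquad \zeta_d=e^{2\pi i/d}.$$ Then $$\sum_{d\mid h,\ d>1}L_{d,m+1}=m-\frac{h+1}2.$$ -}

module Defs where

open import Level using (Level; _⊔_) renaming (suc to lsuc)
open import Algebra.Bundles using (CommutativeRing)
open import Data.Nat as ℕ using (ℕ; zero; suc; _∸_)
open import Data.Nat.Divisibility using (_∣?_)
open import Data.Nat.GCD using (gcd)
open import Data.List using (List; filter; foldr; map; upTo)
open import Relation.Nullary using (¬_)

record Field c ℓ : Set (lsuc (c ⊔ ℓ)) where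
  field
    commutativeRing : CommutativeRing c ℓ
  open CommutativeRing commutativeRing public
  field
    _⁻¹ : Carrier → Carrier
    ⁻¹-inverse : ∀ x → ¬ (x ≈ 0#) → x * (x ⁻¹) ≈ 1#
    1≉0 : ¬ (1# ≈ 0#)

module FieldOps {c ℓ : Level} (F : Field c ℓ) where
  open Field F

  fromℕ : ℕ → Carrier
  fromℕ zero = 0#
  fromℕ (suc n) = 1# + fromℕ n

  pow : Carrier → ℕ → Carrier
  pow x zero = 1#
  pow x (suc n) = x * pow x n

  ∑ : List Carrier → Carrier
  ∑ = foldr _+_ 0#

  CharZero : Set ℓ
  CharZero = ∀ n → ¬ (fromℕ (suc n) ≈ 0#)

  record IsPrimitiveRoot (h : ℕ) (ω : Carrier) : Set ℓ where
    field
      pow-h : pow ω h ≈ 1#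
      pow-k : ∀ k → 1 ℕ.≤ k → k ℕ.< h → ¬ (pow ω k ≈ 1#)

  -- Given a primitive h-th root of unity ω and a divisor d of h,
  -- ζ_d = ω ^ (h / d) is the corresponding primitive d-th root of unity
  -- (for ω = e^{2πi/h} this is e^{2πi/d}).
  ζ : (h : ℕ) (ω : Carrier) (d : ℕ) → .{{_ : ℕ.NonZero d}} → Carrier
  ζ h ω d = pow ω (h ℕ./ d)

  -- L_{d,j} for j = e + 1 (e = j - 1 ≥ 0):
  --   Σ_{1 ≤ k ≤ d-1, gcd(k,d)=1} ζ_d^{k e} / (1 - ζ_d^k)
  L : (h : ℕ) (ω : Carrier) (d : ℕ) → .{{_ : ℕ.NonZero d}} → (e : ℕ) → Carrier
  L h ω d e =
    ∑ (map (λ k → pow (ζ h ω d) (k ℕ.* e) * ((1# - pow (ζ h ω d) k) ⁻¹))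
           (filter (λ k → gcd k d ℕ.≟ 1) (map suc (upTo (d ∸ 1)))))

  -- Σ_{d ∣ h, d > 1} L_{d, e+1}; d ranges over 2, …, h written d = 2 + d'.
  divisorSumL : (h : ℕ) (ω : Carrier) (e : ℕ) → Carrier
  divisorSumL h ω e =
    ∑ (map (λ d' → L h ω (suc (suc d')) e)
           (filter (λ d' → suc (suc d') ∣? h) (upTo (h ∸ 1))))

-- The primitive d-th roots of unity ζ_d ^ k (gcd k d = 1) are exactly the powers ω ^ t,
-- 0 ≤ t < h, with gcd t h · d = h.  Every 0 < t < h has exactly one such d > 1, and t = 0
-- has none, so the divisor sum equals Σ_{0<t<h} ω^{tm} / (1 - ω^t).  Splitting
-- x^m / (1 - x) = 1 / (1 - x) - Σ_{j<m} x^j, the first part sums to (h - 1)/2 by pairing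
-- t with h - t (as 1/(1 - x) + 1/(1 - x⁻¹) = 1), and the second to (h - 1) - (m - 1),
-- because Σ_{0<t<h} ω^{tj} = -1 for 0 < j < h.
module Submission where

open import Algebra.Bundles using (CommutativeMonoid; CommutativeRing)
import Algebra.Properties.CommutativeMonoid.Sum as CommutativeMonoidSum
import Algebra.Properties.CommutativeSemigroup as CommutativeSemigroupProperties
import Algebra.Properties.CommutativeSemiring.Exp as Exp
import Algebra.Properties.Ring as RingProperties
import Algebra.Properties.Semiring.Sum as SemiringSum
open import Data.Fin using (toℕ)
open import Data.Fin.Properties using (toℕ<n; opposite-prop)
import Data.Fin.Permutation as Permutation
open import Data.List using ([]; _∷_; filter; foldr; map; applyUpTo; upTo)
open import Data.List.Properties using (map-∘)
open import Data.Nat using (ℕ; _≤_)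
import Data.Nat
open import Data.Nat as ℕ using (zero; suc; _<_; _∸_; z≤n; s≤s; NonZero)
import Data.Nat.Properties as ℕ
open import Data.Nat.Divisibility using (_∣_; divides; _∣?_; ∣⇒≤; >⇒∤; ∣m+n∣m⇒∣n; ∣-refl)
open import Data.Nat.DivMod using (_/_; m*n/n≡m)
open import Data.Nat.GCD
  using (gcd; gcd[m,n]∣m; gcd[m,n]∣n; gcd[m,n]≢0; gcd-identityˡ; c*gcd[m,n]≡gcd[cm,cn])
open import Data.Product using (∃; _,_)
open import Data.Sum using (inj₂)
open import Function using (_∘_; id; _⇔_; mk⇔; Equivalence)
import Function.Properties.Equivalence as ⇔
open import Relation.Nullary using (¬_; Dec; yes; no; contradiction)
open import Relation.Unary using (Pred; Decidable)
open import Relation.Binary.PropositionalEquality as ≡ using (_≡_; _≢_)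

open import Defs

module RangeSum {c ℓ} (M : CommutativeMonoid c ℓ) where
  open CommutativeMonoid M
    renaming ( _∙_ to _+_; ε to 0#; ∙-cong to +-cong; ∙-congˡ to +-congˡ; ∙-congʳ to +-congʳ
             ; identityˡ to +-identityˡ; identityʳ to +-identityʳ; assoc to +-assoc )
  open CommutativeMonoidSum M
    using (sum; sum-cong-≋; sum-cong-≗; sum-replicate-zero; ∑-distrib-+; ∑-comm; ∑-permute)
  open import Relation.Binary.Reasoning.Setoid setoid

  ∑< : ℕ → (ℕ → Carrier) → Carrier
  ∑< n f = sum {n} (f ∘ toℕ)

  ∑<-cong : ∀ n {f g} → (∀ i → i < n → f i ≈ g i) → ∑< n f ≈ ∑< n g
  ∑<-cong n f≈g = sum-cong-≋ (λ i → f≈g (toℕ i) (toℕ<n i))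

  ∑<-zero : ∀ n {f} → (∀ i → i < n → f i ≈ 0#) → ∑< n f ≈ 0#
  ∑<-zero n f≈0 = trans (∑<-cong n f≈0) (sum-replicate-zero n)

  ∑<-+ : ∀ n f g → ∑< n (λ i → f i + g i) ≈ ∑< n f + ∑< n g
  ∑<-+ n f g = ∑-distrib-+ {n} (f ∘ toℕ) (g ∘ toℕ)

  ∑<-comm : ∀ m n (f : ℕ → ℕ → Carrier) →
            ∑< m (λ i → ∑< n (f i)) ≈ ∑< n (λ j → ∑< m (λ i → f i j))
  ∑<-comm m n f = ∑-comm {m} {n} (λ i j → f (toℕ i) (toℕ j))

  ∑<-reverse : ∀ n f → ∑< n f ≈ ∑< n (λ i → f (n ∸ suc i))
  ∑<-reverse n f = trans (∑-permute {n} (f ∘ toℕ) Permutation.reverse)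
                         (reflexive (sum-cong-≗ {n} (≡.cong f ∘ opposite-prop)))

  ∑<-split : ∀ m n f → ∑< (m ℕ.+ n) f ≈ ∑< m f + ∑< n (λ i → f (m ℕ.+ i))
  ∑<-split zero    n f = sym (+-identityˡ _)
  ∑<-split (suc m) n f = trans (+-congˡ (∑<-split m n (f ∘ suc))) (sym (+-assoc _ _ _))

  ∑<-single : ∀ n {f} j → j < n → (∀ i → i < n → i ≢ j → f i ≈ 0#) → ∑< n f ≈ f j
  ∑<-single (suc n) zero    _         f≈0 =
    trans (+-congˡ (∑<-zero n (λ i i<n → f≈0 (suc i) (s≤s i<n) (λ ())))) (+-identityʳ _)
  ∑<-single (suc n) {f} (suc j) (s≤s j<n) f≈0 =
    trans (+-congʳ (f≈0 0 (s≤s z≤n) (λ ())))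
          (trans (+-identityˡ _) (∑<-single n j j<n others≈0))
    where
      others≈0 : ∀ i → i < n → i ≢ j → f (suc i) ≈ 0#
      others≈0 i i<n i≢j = f≈0 (suc i) (s≤s i<n) (i≢j ∘ ℕ.suc-injective)

  ∑<-multiples : ∀ d q {f} → (∀ i → ¬ suc q ∣ i → f i ≈ 0#) →
                 ∑< (d ℕ.* suc q) f ≈ ∑< d (λ k → f (k ℕ.* suc q))
  ∑<-multiples zero    q f≈0 = refl
  ∑<-multiples (suc d) q {f} f≈0 = begin
    ∑< (suc q ℕ.+ d ℕ.* suc q) f
      ≈⟨ ∑<-split (suc q) (d ℕ.* suc q) f ⟩
    (f 0 + ∑< q (f ∘ suc)) + ∑< (d ℕ.* suc q) (λ i → f (suc q ℕ.+ i))
      ≈⟨ +-cong (+-congˡ (∑<-zero q (λ i i<q → f≈0 (suc i) (>⇒∤ (s≤s i<q)))))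
                (∑<-multiples d q shifted≈0) ⟩
    (f 0 + 0#) + ∑< d (λ k → f (suc k ℕ.* suc q))
      ≈⟨ +-congʳ (+-identityʳ _) ⟩
    ∑< (suc d) (λ k → f (k ℕ.* suc q)) ∎
    where
      shifted≈0 : ∀ i → ¬ suc q ∣ i → f (suc q ℕ.+ i) ≈ 0#
      shifted≈0 i q∤i = f≈0 (suc q ℕ.+ i) (λ q∣q+i → q∤i (∣m+n∣m⇒∣n q∣q+i ∣-refl))

  when : ∀ {p} {P : Set p} → Dec P → Carrier → Carrier
  when (yes _) x = x
  when (no _)  _ = 0#

  module _ {p} {P : Set p} where

    when-yes : ∀ (P? : Dec P) {x} → P → when P? x ≈ x
    when-yes (yes _) _ = refl
    when-yes (no ¬p) p = contradiction p ¬p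

    when-no : ∀ (P? : Dec P) {x} → ¬ P → when P? x ≈ 0#
    when-no (yes p) ¬p = contradiction p ¬p
    when-no (no _)  _  = refl

    when-congʳ : ∀ (P? : Dec P) {x y} → (P → x ≈ y) → when P? x ≈ when P? y
    when-congʳ (yes p) x≈y = x≈y p
    when-congʳ (no _)  _   = refl

    when-∑< : ∀ (P? : Dec P) n f → when P? (∑< n f) ≈ ∑< n (λ i → when P? (f i))
    when-∑< (yes _) n f = refl
    when-∑< (no _)  n f = sym (∑<-zero n (λ _ _ → refl))

  when-cong : ∀ {p q} {P : Set p} {Q : Set q} (P? : Dec P) (Q? : Dec Q) {x y} →
              P ⇔ Q → x ≈ y → when P? x ≈ when Q? y
  when-cong (yes _) (yes _) _   x≈y = x≈y
  when-cong (yes p) (no ¬q) P⇔Q _   = contradiction (Equivalence.to P⇔Q p) ¬q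
  when-cong (no ¬p) (yes q) P⇔Q _   = contradiction (Equivalence.from P⇔Q q) ¬p
  when-cong (no _)  (no _)  _   _   = refl

  when-when : ∀ {p q} {P : Set p} {Q : Set q} (P? : Dec P) (Q? : Dec Q) {x} →
              (Q → P) → when P? (when Q? x) ≈ when Q? x
  when-when (yes _) _       _   = refl
  when-when (no ¬p) (yes q) Q⇒P = contradiction (Q⇒P q) ¬p
  when-when (no _)  (no _)  _   = refl

  ∑-filter : ∀ {a p} {A : Set a} {P : Pred A p} (P? : Decidable P) (f : A → Carrier) xs →
             foldr _+_ 0# (map f (filter P? xs)) ≈ foldr _+_ 0# (map (λ x → when (P? x) (f x)) xs)
  ∑-filter P? f []       = refl
  ∑-filter P? f (x ∷ xs) with P? x
  ... | yes _ = +-congˡ (∑-filter P? f xs)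
  ... | no  _ = trans (∑-filter P? f xs) (sym (+-identityˡ _))

  ∑-applyUpTo : ∀ {a} {A : Set a} (f : A → Carrier) (g : ℕ → A) n →
                foldr _+_ 0# (map f (applyUpTo g n)) ≡ ∑< n (f ∘ g)
  ∑-applyUpTo f g zero    = ≡.refl
  ∑-applyUpTo f g (suc n) = ≡.cong (f (g 0) +_) (∑-applyUpTo f (g ∘ suc) n)

module CommutativeRingFacts {c ℓ} (R : CommutativeRing c ℓ) where
  open CommutativeRing R
  open RingProperties ring
    using (⁻¹-anti-homo‿-; -0#≈0#; -‿+-comm; x[y-z]≈xy-xz; //-rightDividesˡ; \\-leftDividesʳ)
  open SemiringSum semiring using (*-distribˡ-sum)
  open CommutativeSemigroupProperties *-commutativeSemigroup using (x∙yz≈y∙xz)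
  open Exp commutativeSemiring public using (_^_; ^-congˡ; ^-congʳ; ^-homo-*; ^-assocʳ)
  open RangeSum +-commutativeMonoid public
  open import Relation.Binary.Reasoning.Setoid setoid

  ∑<-neg : ∀ n f → ∑< n (λ i → - f i) ≈ - ∑< n f
  ∑<-neg zero    f = sym -0#≈0#
  ∑<-neg (suc n) f = trans (+-congˡ (∑<-neg n (f ∘ suc))) (-‿+-comm _ _)

  ∑<-minus : ∀ n f g → ∑< n (λ i → f i - g i) ≈ ∑< n f - ∑< n g
  ∑<-minus n f g = trans (∑<-+ n f (λ i → - g i)) (+-congˡ (∑<-neg n g))

  x-[x-y]≈y : ∀ x y → x - (x - y) ≈ y
  x-[x-y]≈y x y = begin
    x - (x - y)  ≈⟨ +-congˡ (⁻¹-anti-homo‿- x y) ⟩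
    x + (y - x)  ≈⟨ +-comm x (y - x) ⟩
    (y - x) + x  ≈⟨ //-rightDividesˡ x y ⟩
    y            ∎

  1^n≈1 : ∀ n → 1# ^ n ≈ 1#
  1^n≈1 zero    = refl
  1^n≈1 (suc n) = trans (*-identityˡ _) (1^n≈1 n)

  ^-swap : ∀ x i j → (x ^ i) ^ j ≈ (x ^ j) ^ i
  ^-swap x i j = begin
    (x ^ i) ^ j    ≈⟨ ^-assocʳ x i j ⟩
    x ^ (i ℕ.* j)  ≈⟨ ^-congʳ x (ℕ.*-comm i j) ⟩
    x ^ (j ℕ.* i)  ≈⟨ ^-assocʳ x j i ⟨
    (x ^ j) ^ i    ∎

  ^-root : ∀ {x h} j → x ^ h ≈ 1# → (x ^ j) ^ h ≈ 1#
  ^-root {x} {h} j x^h≈1 = trans (^-swap x j h) (trans (^-congˡ j x^h≈1) (1^n≈1 j))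

  *-inverse-unique : ∀ {x y z} → x * y ≈ 1# → x * z ≈ 1# → y ≈ z
  *-inverse-unique {x} {y} {z} xy≈1 xz≈1 = begin
    y            ≈⟨ *-identityʳ y ⟨
    y * 1#       ≈⟨ *-congˡ xz≈1 ⟨
    y * (x * z)  ≈⟨ *-assoc y x z ⟨
    (y * x) * z  ≈⟨ *-congʳ (trans (*-comm y x) xy≈1) ⟩
    1# * z       ≈⟨ *-identityˡ z ⟩
    z            ∎

  geometric-sum : ∀ y m → (1# - y) * ∑< m (y ^_) ≈ 1# - y ^ m
  geometric-sum y zero    = trans (zeroʳ _) (sym (-‿inverseʳ 1#))
  geometric-sum y (suc m) = begin
    (1# - y) * (1# + ∑< m (λ i → y * y ^ i))
      ≈⟨ distribˡ _ _ _ ⟩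
    (1# - y) * 1# + (1# - y) * ∑< m (λ i → y * y ^ i)
      ≈⟨ +-cong (*-identityʳ _) (*-congˡ (sym (*-distribˡ-sum {m} y ((y ^_) ∘ toℕ)))) ⟩
    (1# - y) + (1# - y) * (y * ∑< m (y ^_))
      ≈⟨ +-congˡ (x∙yz≈y∙xz (1# - y) y _) ⟩
    (1# - y) + y * ((1# - y) * ∑< m (y ^_))
      ≈⟨ +-congˡ (*-congˡ (geometric-sum y m)) ⟩
    (1# - y) + y * (1# - y ^ m)
      ≈⟨ +-congˡ (trans (x[y-z]≈xy-xz y 1# (y ^ m)) (+-congʳ (*-identityʳ y))) ⟩
    (1# - y) + (y - y * y ^ m)
      ≈⟨ +-assoc _ _ _ ⟩
    1# + (- y + (y - y * y ^ m))
      ≈⟨ +-congˡ (\\-leftDividesʳ y _) ⟩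
    1# - y * y ^ m ∎

module FieldFacts {c ℓ} (F : Field c ℓ) where
  open Field F
  open FieldOps F
  open CommutativeRingFacts commutativeRing public
  open RingProperties ring
    using ( x∙y⁻¹≈ε⇒x≈y; [y-z]x≈yx-zx; ⁻¹-anti-homo‿-; -‿distribʳ-*; -‿distribˡ-*
          ; x≈z//y; \\-leftDividesʳ )
  open CommutativeSemigroupProperties +-commutativeSemigroup using (xy∙z≈xz∙y)
  open import Relation.Binary.Reasoning.Setoid setoid

  pow≡^ : ∀ x n → pow x n ≡ x ^ n
  pow≡^ x zero    = ≡.refl
  pow≡^ x (suc n) = ≡.cong (x *_) (pow≡^ x n)

  fromℕ-+ : ∀ m n → fromℕ (m ℕ.+ n) ≈ fromℕ m + fromℕ n
  fromℕ-+ zero    n = sym (+-identityˡ _)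
  fromℕ-+ (suc m) n = trans (+-congˡ (fromℕ-+ m n)) (sym (+-assoc _ _ _))

  ∑<-1 : ∀ n → ∑< n (λ _ → 1#) ≈ fromℕ n
  ∑<-1 zero    = refl
  ∑<-1 (suc n) = +-congˡ (∑<-1 n)

  x*y≈0⇒y≈0 : ∀ {x y} → ¬ x ≈ 0# → x * y ≈ 0# → y ≈ 0#
  x*y≈0⇒y≈0 {x} {y} x≉0 xy≈0 = begin
    y               ≈⟨ *-identityˡ y ⟨
    1# * y          ≈⟨ *-congʳ (trans (*-comm _ _) (⁻¹-inverse x x≉0)) ⟨
    (x ⁻¹ * x) * y  ≈⟨ *-assoc _ _ _ ⟩
    x ⁻¹ * (x * y)  ≈⟨ *-congˡ xy≈0 ⟩
    x ⁻¹ * 0#       ≈⟨ zeroʳ _ ⟩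
    0#              ∎

  ⁻¹-cong : ∀ {x y} → x ≈ y → ¬ y ≈ 0# → x ⁻¹ ≈ y ⁻¹
  ⁻¹-cong {x} {y} x≈y y≉0 = *-inverse-unique (trans (*-congʳ (sym x≈y)) (⁻¹-inverse x x≉0))
                                              (⁻¹-inverse y y≉0)
    where
      x≉0 : ¬ x ≈ 0#
      x≉0 x≈0 = y≉0 (trans (sym x≈y) x≈0)

  1-x≉0 : ∀ {x} → ¬ x ≈ 1# → ¬ 1# - x ≈ 0#
  1-x≉0 x≉1 1-x≈0 = x≉1 (sym (x∙y⁻¹≈ε⇒x≈y _ _ 1-x≈0))

  [1-x]⁻¹+[1-y]⁻¹≈1 : ∀ {x y} → x * y ≈ 1# → ¬ x ≈ 1# → (1# - x) ⁻¹ + (1# - y) ⁻¹ ≈ 1#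
  [1-x]⁻¹+[1-y]⁻¹≈1 {x} {y} xy≈1 x≉1 = begin
    u + (1# - y) ⁻¹  ≈⟨ +-congˡ (*-inverse-unique [1-y][-xu]≈1 (⁻¹-inverse (1# - y) (1-x≉0 y≉1))) ⟨
    u - x * u        ≈⟨ +-congʳ (*-identityˡ u) ⟨
    1# * u - x * u   ≈⟨ [y-z]x≈yx-zx u 1# x ⟨
    (1# - x) * u     ≈⟨ ⁻¹-inverse (1# - x) (1-x≉0 x≉1) ⟩
    1#               ∎
    where
      u = (1# - x) ⁻¹
      y≉1 : ¬ y ≈ 1#
      y≉1 y≈1 = x≉1 (trans (sym (*-identityʳ x)) (trans (*-congˡ (sym y≈1)) xy≈1))
      [1-y][-xu]≈1 : (1# - y) * - (x * u) ≈ 1#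
      [1-y][-xu]≈1 = begin
        (1# - y) * - (x * u)      ≈⟨ -‿distribʳ-* _ _ ⟨
        - ((1# - y) * (x * u))    ≈⟨ -‿cong (*-assoc _ _ _) ⟨
        - (((1# - y) * x) * u)    ≈⟨ -‿cong (*-congʳ ([y-z]x≈yx-zx x 1# y)) ⟩
        - ((1# * x - y * x) * u)  ≈⟨ -‿cong (*-congʳ (+-cong (*-identityˡ x) (-‿cong yx≈1))) ⟩
        - ((x - 1#) * u)          ≈⟨ -‿distribˡ-* _ _ ⟩
        - (x - 1#) * u            ≈⟨ *-congʳ (⁻¹-anti-homo‿- x 1#) ⟩
        (1# - x) * u              ≈⟨ ⁻¹-inverse (1# - x) (1-x≉0 x≉1) ⟩
        1#                        ∎
        where
          yx≈1 = trans (*-comm y x) xy≈1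

  ∑<-root-powers : ∀ {z} h → z ^ h ≈ 1# → ¬ z ≈ 1# → ∑< h (z ^_) ≈ 0#
  ∑<-root-powers {z} h z^h≈1 z≉1 = x*y≈0⇒y≈0 (1-x≉0 z≉1) (begin
    (1# - z) * ∑< h (z ^_)  ≈⟨ geometric-sum z h ⟩
    1# - z ^ h              ≈⟨ +-congˡ (-‿cong z^h≈1) ⟩
    1# - 1#                 ≈⟨ -‿inverseʳ 1# ⟩
    0#                      ∎)

  geometricTail : ℕ → Carrier → Carrier
  geometricTail e x = x ^ e * (1# - x) ⁻¹

  geometricTail-cong : ∀ e {x y} → x ≈ y → ¬ y ≈ 1# → geometricTail e x ≈ geometricTail e y
  geometricTail-cong e x≈y y≉1 =
    *-cong (^-congˡ e x≈y) (⁻¹-cong (+-congˡ (-‿cong x≈y)) (1-x≉0 y≉1))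

  geometricTail-split : ∀ e {y} → ¬ y ≈ 1# → geometricTail e y ≈ (1# - y) ⁻¹ - ∑< e (y ^_)
  geometricTail-split e {y} y≉1 = sym (begin
    v - S            ≈⟨ +-congˡ (-‿cong S≈v-wv) ⟩
    v - (v - w * v)  ≈⟨ x-[x-y]≈y v (w * v) ⟩
    w * v            ∎)
    where
      v = (1# - y) ⁻¹
      w = y ^ e
      S = ∑< e (y ^_)
      S≈v-wv : S ≈ v - w * v
      S≈v-wv = begin
        S                   ≈⟨ *-identityˡ S ⟨
        1# * S              ≈⟨ *-congʳ (⁻¹-inverse (1# - y) (1-x≉0 y≉1)) ⟨
        ((1# - y) * v) * S  ≈⟨ *-assoc _ _ _ ⟩
        (1# - y) * (v * S)  ≈⟨ *-congˡ (*-comm v S) ⟩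
        (1# - y) * (S * v)  ≈⟨ *-assoc _ _ _ ⟨
        ((1# - y) * S) * v  ≈⟨ *-congʳ (geometric-sum y e) ⟩
        (1# - w) * v        ≈⟨ [y-z]x≈yx-zx v 1# w ⟩
        1# * v - w * v      ≈⟨ +-congʳ (*-identityˡ v) ⟩
        v - w * v           ∎

  summand≈geometricTail : ∀ x k e → pow x (k ℕ.* e) * (1# - pow x k) ⁻¹ ≈ geometricTail e (x ^ k)
  summand≈geometricTail x k e =
    *-cong (trans (reflexive (pow≡^ x (k ℕ.* e))) (sym (^-assocʳ x k e)))
           (reflexive (≡.cong (λ y → (1# - y) ⁻¹) (pow≡^ x k)))

  x*2≈x+x : ∀ x → x * fromℕ 2 ≈ x + x
  x*2≈x+x x = trans (distribˡ x 1# (1# + 0#))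
                    (+-cong (*-identityʳ x) (trans (*-congˡ (+-identityʳ 1#)) (*-identityʳ x)))

  module Halving (2≉0 : ¬ fromℕ 2 ≈ 0#) where

    ½ : Carrier
    ½ = fromℕ 2 ⁻¹

    x+x≈y⇒x≈y½ : ∀ {x y} → x + x ≈ y → x ≈ y * ½
    x+x≈y⇒x≈y½ {x} {y} x+x≈y = begin
      x                  ≈⟨ *-identityʳ x ⟨
      x * 1#             ≈⟨ *-congˡ (⁻¹-inverse (fromℕ 2) 2≉0) ⟨
      x * (fromℕ 2 * ½)  ≈⟨ *-assoc _ _ _ ⟨
      (x * fromℕ 2) * ½  ≈⟨ *-congʳ (trans (x*2≈x+x x) x+x≈y) ⟩
      y * ½              ∎

    n/2-[n-m]≈[m+1]-[n+2]/2 : ∀ {a} n m → a + a ≈ fromℕ n →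
                              a - (fromℕ n - fromℕ m) ≈ fromℕ (suc m) - fromℕ (suc n ℕ.+ 1) * ½
    n/2-[n-m]≈[m+1]-[n+2]/2 {a} n m a+a≈n = begin
      a - (N - M)   ≈⟨ x≈z//y _ a M [a-[N-M]]+a≈M ⟩
      M - a         ≈⟨ x≈z//y _ X _ [M-a]+X≈1+M ⟩
      (1# + M) - X  ∎
      where
        N = fromℕ n
        M = fromℕ m
        X = fromℕ (suc n ℕ.+ 1) * ½
        [a-[N-M]]+a≈M : (a - (N - M)) + a ≈ M
        [a-[N-M]]+a≈M = begin
          (a - (N - M)) + a  ≈⟨ xy∙z≈xz∙y a (- (N - M)) a ⟩
          (a + a) - (N - M)  ≈⟨ +-congʳ a+a≈n ⟩
          N - (N - M)        ≈⟨ x-[x-y]≈y N M ⟩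
          M                  ∎
        X≈a+1 : X ≈ a + 1#
        X≈a+1 = begin
          fromℕ (suc n ℕ.+ 1) * ½  ≡⟨ ≡.cong (λ k → fromℕ k * ½) (≡.sym (ℕ.+-suc n 1)) ⟩
          fromℕ (n ℕ.+ 2) * ½      ≈⟨ *-congʳ (fromℕ-+ n 2) ⟩
          (N + fromℕ 2) * ½        ≈⟨ distribʳ ½ N (fromℕ 2) ⟩
          N * ½ + fromℕ 2 * ½      ≈⟨ +-cong (sym (x+x≈y⇒x≈y½ a+a≈n)) (⁻¹-inverse (fromℕ 2) 2≉0) ⟩
          a + 1#                   ∎
        [M-a]+X≈1+M : (M - a) + X ≈ 1# + M
        [M-a]+X≈1+M = begin
          (M - a) + X           ≈⟨ +-congˡ X≈a+1 ⟩
          (M - a) + (a + 1#)    ≈⟨ +-assoc _ _ _ ⟩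
          M + (- a + (a + 1#))  ≈⟨ +-congˡ (\\-leftDividesʳ a 1#) ⟩
          M + 1#                ≈⟨ +-comm M 1# ⟩
          1# + M                ∎

-- t has order d in ℤ/hℤ; for a primitive h-th root of unity ω, ω ^ t is then a primitive d-th one
HasOrder : ℕ → ℕ → ℕ → Set
HasOrder h t d = gcd t h ℕ.* d ≡ h

hasOrder? : ∀ h t d → Dec (HasOrder h t d)
hasOrder? h t d = gcd t h ℕ.* d ℕ.≟ h

order-divides : ∀ {h t d} → HasOrder h t d → d ∣ h
order-divides {h} {t} o = divides (gcd t h) (≡.sym o)

order-unique : ∀ {h t d e} .{{_ : NonZero h}} → HasOrder h t d → HasOrder h t e → d ≡ e
order-unique {h} {t} {d} {e} o₁ o₂ = ℕ.*-cancelˡ-≡ d e (gcd t h) {{gcd≢0}} (≡.trans o₁ (≡.sym o₂))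
  where
    gcd≢0 : NonZero (gcd t h)
    gcd≢0 = ℕ.≢-nonZero (gcd[m,n]≢0 t h (inj₂ (ℕ.≢-nonZero⁻¹ h)))

order-of-zero : ∀ {h d} .{{_ : NonZero h}} → HasOrder h 0 d → d ≡ 1
order-of-zero {h} {d} o =
  order-unique {h} {0} {d} {1} o (≡.trans (ℕ.*-identityʳ (gcd 0 h)) (gcd-identityˡ h))

order-exists : ∀ {h t} → suc t < h → ∃ λ d → HasOrder h (suc t) (suc (suc d))
order-exists {h} {t} t<h with gcd[m,n]∣n (suc t) h
... | divides zero h≡0 = contradiction (≡.subst (suc t <_) h≡0 t<h) λ ()
... | divides (suc zero) h≡g =
  contradiction (∣⇒≤ (gcd[m,n]∣m (suc t) h))
                (ℕ.<⇒≱ (≡.subst (suc t <_) (≡.trans h≡g (ℕ.+-identityʳ _)) t<h))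
... | divides (suc (suc d)) h≡dg =
  d , ≡.trans (ℕ.*-comm (gcd (suc t) h) (suc (suc d))) (≡.sym h≡dg)

order-multiple : ∀ {h q d t} .{{_ : NonZero d}} → h ≡ q ℕ.* d → HasOrder h t d → q ∣ t
order-multiple {h} {q} {d} {t} h≡qd o =
  ≡.subst (_∣ t) (ℕ.*-cancelʳ-≡ (gcd t h) q d (≡.trans o h≡qd)) (gcd[m,n]∣m t h)

order-of-multiple : ∀ {h q d} k .{{_ : NonZero q}} .{{_ : NonZero d}} → h ≡ q ℕ.* d →
                    HasOrder h (k ℕ.* q) d ⇔ gcd k d ≡ 1
order-of-multiple {h} {q} {d} k h≡qd = mk⇔ to from
  where
    open ≡.≡-Reasoning
    gcd-scaled : gcd (k ℕ.* q) h ≡ q ℕ.* gcd k d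
    gcd-scaled = ≡.trans (≡.cong₂ gcd (ℕ.*-comm k q) h≡qd) (≡.sym (c*gcd[m,n]≡gcd[cm,cn] q k d))
    to : HasOrder h (k ℕ.* q) d → gcd k d ≡ 1
    to o = ℕ.*-cancelʳ-≡ (gcd k d) 1 d (ℕ.*-cancelˡ-≡ _ _ q (begin
      q ℕ.* (gcd k d ℕ.* d)  ≡⟨ ℕ.*-assoc q (gcd k d) d ⟨
      q ℕ.* gcd k d ℕ.* d    ≡⟨ ≡.cong (ℕ._* d) gcd-scaled ⟨
      gcd (k ℕ.* q) h ℕ.* d  ≡⟨ ≡.trans o h≡qd ⟩
      q ℕ.* d                ≡⟨ ≡.cong (q ℕ.*_) (ℕ.*-identityˡ d) ⟨
      q ℕ.* (1 ℕ.* d)        ∎))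
    from : gcd k d ≡ 1 → HasOrder h (k ℕ.* q) d
    from coprime = begin
      gcd (k ℕ.* q) h ℕ.* d  ≡⟨ ≡.cong (ℕ._* d) gcd-scaled ⟩
      q ℕ.* gcd k d ℕ.* d    ≡⟨ ≡.cong (λ g → q ℕ.* g ℕ.* d) coprime ⟩
      q ℕ.* 1 ℕ.* d          ≡⟨ ≡.cong (ℕ._* d) (ℕ.*-identityʳ q) ⟩
      q ℕ.* d                ≡⟨ h≡qd ⟨
      h                      ∎

module OrderSum {c ℓ} (M : CommutativeMonoid c ℓ) (n : ℕ) where
  open CommutativeMonoid M renaming (ε to 0#)
  open RangeSum M

  ∑<-hasOrder-zero : ∀ x → ∑< n (λ d → when (hasOrder? (suc n) 0 (suc (suc d))) x) ≈ 0#
  ∑<-hasOrder-zero x = ∑<-zero n (λ d _ → when-no (hasOrder? (suc n) 0 (suc (suc d))) (d+2≢1 d))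
    where
      d+2≢1 : ∀ d → ¬ HasOrder (suc n) 0 (suc (suc d))
      d+2≢1 d o = ℕ.1+n≢0 (ℕ.suc-injective (order-of-zero {suc n} o))

  ∑<-hasOrder-suc : ∀ {t} → suc t < suc n → ∀ x →
                    ∑< n (λ d → when (hasOrder? (suc n) (suc t) (suc (suc d))) x) ≈ x
  ∑<-hasOrder-suc {t} t<h x with order-exists t<h
  ... | d₀ , o₀ = trans (∑<-single n d₀ d₀<n others≈0)
                        (when-yes (hasOrder? (suc n) (suc t) (suc (suc d₀))) o₀)
    where
      d₀<n : d₀ < n
      d₀<n = ℕ.≤-pred (∣⇒≤ (order-divides {suc n} {suc t} o₀))
      others≈0 : ∀ d → d < n → d ≢ d₀ → when (hasOrder? (suc n) (suc t) (suc (suc d))) x ≈ 0#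
      others≈0 d _ d≢d₀ = when-no (hasOrder? (suc n) (suc t) (suc (suc d))) λ o →
        d≢d₀ (ℕ.suc-injective (ℕ.suc-injective (order-unique {suc n} {suc t} o o₀)))

module PrimitiveRoot {c ℓ} (F : Field c ℓ) {n : ℕ} {ω : Field.Carrier F}
                     (prim : FieldOps.IsPrimitiveRoot F (suc n) ω) where
  open Field F
  open FieldOps F
  open FieldFacts F
  open IsPrimitiveRoot prim
  open OrderSum +-commutativeMonoid n
  open RingProperties ring using (+-inverseʳ-unique)
  open import Relation.Binary.Reasoning.Setoid setoid

  ω^h≈1 : ω ^ suc n ≈ 1#
  ω^h≈1 = trans (reflexive (≡.sym (pow≡^ ω (suc n)))) pow-h

  ω^t≉1 : ∀ {t} → 0 < t → t < suc n → ¬ ω ^ t ≈ 1#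
  ω^t≉1 {t} 0<t t<h ω^t≈1 = pow-k t 0<t t<h (trans (reflexive (pow≡^ ω t)) ω^t≈1)

  reciprocalSum : Carrier
  reciprocalSum = ∑< n (λ i → (1# - ω ^ suc i) ⁻¹)

  reciprocalSum-doubled : reciprocalSum + reciprocalSum ≈ fromℕ n
  reciprocalSum-doubled = begin
    ∑< n u + ∑< n u                      ≈⟨ +-congˡ (∑<-reverse n u) ⟩
    ∑< n u + ∑< n (λ i → u (n ∸ suc i))  ≈⟨ ∑<-+ n u (λ i → u (n ∸ suc i)) ⟨
    ∑< n (λ i → u i + u (n ∸ suc i))     ≈⟨ ∑<-cong n pair≈1 ⟩
    ∑< n (λ _ → 1#)                      ≈⟨ ∑<-1 n ⟩
    fromℕ n                              ∎
    where
      u : ℕ → Carrier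
      u i = (1# - ω ^ suc i) ⁻¹
      ω^complement : ∀ {i} → i < n → ω ^ suc i * ω ^ suc (n ∸ suc i) ≈ 1#
      ω^complement {i} i<n = begin
        ω ^ suc i * ω ^ suc (n ∸ suc i)  ≈⟨ ^-homo-* ω (suc i) (suc (n ∸ suc i)) ⟨
        ω ^ (suc i ℕ.+ suc (n ∸ suc i))  ≡⟨ ≡.cong (ω ^_) (ℕ.+-suc (suc i) (n ∸ suc i)) ⟩
        ω ^ suc (suc i ℕ.+ (n ∸ suc i))  ≡⟨ ≡.cong (λ k → ω ^ suc k) (ℕ.m+[n∸m]≡n i<n) ⟩
        ω ^ suc n                        ≈⟨ ω^h≈1 ⟩
        1#                               ∎
      pair≈1 : ∀ i → i < n → u i + u (n ∸ suc i) ≈ 1#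
      pair≈1 i i<n = [1-x]⁻¹+[1-y]⁻¹≈1 (ω^complement i<n) (ω^t≉1 (s≤s z≤n) (s≤s i<n))

  ∑<-powers-of-ω^t : ∀ {j} → 0 < j → j < suc n → ∑< n (λ i → (ω ^ suc i) ^ j) ≈ - 1#
  ∑<-powers-of-ω^t {j} 0<j j<h =
    trans (∑<-cong n (λ i _ → ^-swap ω (suc i) j)) (+-inverseʳ-unique 1# _ all-powers)
    where
      all-powers : ∑< (suc n) ((ω ^ j) ^_) ≈ 0#
      all-powers = ∑<-root-powers (suc n) (^-root {ω} {suc n} j ω^h≈1) (ω^t≉1 0<j j<h)

  ∑<-∑<-powers : ∀ m → m < suc n → ∑< n (λ i → ∑< (suc m) ((ω ^ suc i) ^_)) ≈ fromℕ n - fromℕ m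
  ∑<-∑<-powers m m<h = begin
    ∑< n (λ i → ∑< (suc m) ((ω ^ suc i) ^_))
      ≈⟨ ∑<-comm n (suc m) (λ i → (ω ^ suc i) ^_) ⟩
    ∑< n (λ _ → 1#) + ∑< m (λ j → ∑< n (λ i → (ω ^ suc i) ^ suc j))
      ≈⟨ +-cong (∑<-1 n) (∑<-cong m (λ j j<m → ∑<-powers-of-ω^t (s≤s z≤n) (ℕ.≤-<-trans j<m m<h))) ⟩
    fromℕ n + ∑< m (λ _ → - 1#)
      ≈⟨ +-congˡ (trans (∑<-neg m (λ _ → 1#)) (-‿cong (∑<-1 m))) ⟩
    fromℕ n - fromℕ m ∎

  ∑<-geometricTails : ∀ m → m < suc n →
                      ∑< n (λ i → geometricTail (suc m) (ω ^ suc i))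
                        ≈ reciprocalSum - (fromℕ n - fromℕ m)
  ∑<-geometricTails m m<h = begin
    ∑< n (λ i → geometricTail (suc m) (ω ^ suc i))
      ≈⟨ ∑<-cong n (λ i i<n → geometricTail-split (suc m) (ω^t≉1 (s≤s z≤n) (s≤s i<n))) ⟩
    ∑< n (λ i → (1# - ω ^ suc i) ⁻¹ - ∑< (suc m) ((ω ^ suc i) ^_))
      ≈⟨ ∑<-minus n (λ i → (1# - ω ^ suc i) ⁻¹) (λ i → ∑< (suc m) ((ω ^ suc i) ^_)) ⟩
    reciprocalSum - ∑< n (λ i → ∑< (suc m) ((ω ^ suc i) ^_))
      ≈⟨ +-congˡ (-‿cong (∑<-∑<-powers m m<h)) ⟩
    reciprocalSum - (fromℕ n - fromℕ m) ∎

  orderSum : ℕ → ℕ → Carrier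
  orderSum e d = ∑< (suc n) (λ t → when (hasOrder? (suc n) t d) (geometricTail e (ω ^ t)))

  -- With h = Q D we have ζ_D ^ k = ω ^ (k Q), and the ω ^ t of order D are exactly the
  -- ω ^ (k Q) with gcd k D ≡ 1.
  L≈orderSum : ∀ e d → suc (suc d) ∣ suc n → L (suc n) ω (suc (suc d)) e ≈ orderSum e (suc (suc d))
  L≈orderSum e d (divides (suc q) h≡QD) = begin
    L (suc n) ω D e
      ≈⟨ ∑-filter (λ k → gcd k D ℕ.≟ 1) T (map suc (upTo (suc d))) ⟩
    foldr _+_ 0# (map (λ k → when (gcd k D ℕ.≟ 1) (T k)) (map suc (upTo (suc d))))
      ≡⟨ ≡.trans (≡.cong (foldr _+_ 0#) (≡.sym (map-∘ (upTo (suc d))))) (∑-applyUpTo _ id (suc d)) ⟩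
    ∑< (suc d) (λ i → when (gcd (suc i) D ℕ.≟ 1) (T (suc i)))
      ≈⟨ ∑<-cong (suc d) (λ i i<d →
           when-congʳ (gcd (suc i) D ℕ.≟ 1) (λ _ → T≈G (s≤s z≤n) (s≤s i<d))) ⟩
    ∑< (suc d) (λ i → when (gcd (suc i) D ℕ.≟ 1) (G (suc i ℕ.* Q)))
      ≈⟨ trans (+-congʳ (when-no (gcd 0 D ℕ.≟ 1) {G 0} (λ ()))) (+-identityˡ _) ⟨
    ∑< D (λ k → when (gcd k D ℕ.≟ 1) (G (k ℕ.* Q)))
      ≈⟨ ∑<-cong D (λ k _ → when-cong (gcd k D ℕ.≟ 1) (hasOrder? (suc n) (k ℕ.* Q) D) {G (k ℕ.* Q)}
                                      (⇔.sym (order-of-multiple {suc n} {Q} {D} k h≡QD)) refl) ⟩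
    ∑< D (λ k → when (hasOrder? (suc n) (k ℕ.* Q) D) (G (k ℕ.* Q)))
      ≈⟨ ∑<-multiples D q off-multiples≈0 ⟨
    ∑< (D ℕ.* Q) (λ t → when (hasOrder? (suc n) t D) (G t))
      ≡⟨ ≡.cong (λ k → ∑< k (λ t → when (hasOrder? (suc n) t D) (G t))) D*Q≡h ⟩
    orderSum e D ∎
    where
      D = suc (suc d)
      Q = suc q
      D*Q≡h : D ℕ.* Q ≡ suc n
      D*Q≡h = ≡.trans (ℕ.*-comm D Q) (≡.sym h≡QD)
      T : ℕ → Carrier
      T k = pow (ζ (suc n) ω D) (k ℕ.* e) * (1# - pow (ζ (suc n) ω D) k) ⁻¹
      G : ℕ → Carrier
      G t = geometricTail e (ω ^ t)
      h/D≡Q : suc n / D ≡ Q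
      h/D≡Q = ≡.trans (≡.cong (_/ D) h≡QD) (m*n/n≡m Q D)
      ζ^k≈ω^kQ : ∀ k → ζ (suc n) ω D ^ k ≈ ω ^ (k ℕ.* Q)
      ζ^k≈ω^kQ k = begin
        pow ω (suc n / D) ^ k  ≡⟨ ≡.cong (_^ k) (pow≡^ ω (suc n / D)) ⟩
        (ω ^ (suc n / D)) ^ k  ≈⟨ ^-assocʳ ω (suc n / D) k ⟩
        ω ^ (suc n / D ℕ.* k)  ≡⟨ ≡.cong (λ j → ω ^ (j ℕ.* k)) h/D≡Q ⟩
        ω ^ (Q ℕ.* k)          ≡⟨ ≡.cong (ω ^_) (ℕ.*-comm Q k) ⟩
        ω ^ (k ℕ.* Q)          ∎
      T≈G : ∀ {k} → 0 < k → k < D → T k ≈ G (k ℕ.* Q)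
      T≈G {k} 0<k k<D = trans (summand≈geometricTail (ζ (suc n) ω D) k e)
                              (geometricTail-cong e (ζ^k≈ω^kQ k) (ω^t≉1 0<kQ kQ<h))
        where
          0<kQ : 0 < k ℕ.* Q
          0<kQ = ℕ.*-monoˡ-< Q 0<k
          kQ<h : k ℕ.* Q < suc n
          kQ<h = ≡.subst (k ℕ.* Q <_) D*Q≡h (ℕ.*-monoˡ-< Q k<D)
      off-multiples≈0 : ∀ t → ¬ Q ∣ t → when (hasOrder? (suc n) t D) (G t) ≈ 0#
      off-multiples≈0 t Q∤t =
        when-no (hasOrder? (suc n) t D) (Q∤t ∘ order-multiple {suc n} {Q} {D} {t} h≡QD)

  divisorSumL≈ : ∀ e → divisorSumL (suc n) ω e ≈ ∑< n (λ i → geometricTail e (ω ^ suc i))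
  divisorSumL≈ e = begin
    divisorSumL (suc n) ω e
      ≈⟨ ∑-filter D∣h? (λ d → L (suc n) ω (suc (suc d)) e) (upTo n) ⟩
    foldr _+_ 0# (map (λ d → when (D∣h? d) (L (suc n) ω (suc (suc d)) e)) (upTo n))
      ≡⟨ ∑-applyUpTo _ id n ⟩
    ∑< n (λ d → when (D∣h? d) (L (suc n) ω (suc (suc d)) e))
      ≈⟨ ∑<-cong n (λ d _ → when-congʳ (D∣h? d) (L≈orderSum e d)) ⟩
    ∑< n (λ d → when (D∣h? d) (orderSum e (suc (suc d))))
      ≈⟨ ∑<-cong n (λ d _ → when-∑< (D∣h? d) (suc n) (λ t → when (O? t d) (G t))) ⟩
    ∑< n (λ d → ∑< (suc n) (λ t → when (D∣h? d) (when (O? t d) (G t))))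
      ≈⟨ ∑<-cong n (λ d _ → ∑<-cong (suc n) (λ t _ →
           when-when (D∣h? d) (O? t d) {G t} (order-divides {suc n} {t}))) ⟩
    ∑< n (λ d → ∑< (suc n) (λ t → when (O? t d) (G t)))
      ≈⟨ ∑<-comm n (suc n) (λ d t → when (O? t d) (G t)) ⟩
    ∑< (suc n) (λ t → ∑< n (λ d → when (O? t d) (G t)))
      ≈⟨ +-cong (∑<-hasOrder-zero (G 0))
                (∑<-cong n (λ t t<n → ∑<-hasOrder-suc (s≤s t<n) (G (suc t)))) ⟩
    0# + ∑< n (λ t → G (suc t))
      ≈⟨ +-identityˡ _ ⟩
    ∑< n (λ i → geometricTail e (ω ^ suc i)) ∎
    where
      D∣h? : ∀ d → Dec (suc (suc d) ∣ suc n)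
      D∣h? d = suc (suc d) ∣? suc n
      O? : ∀ t d → Dec (HasOrder (suc n) t (suc (suc d)))
      O? t d = hasOrder? (suc n) t (suc (suc d))
      G : ℕ → Carrier
      G t = geometricTail e (ω ^ t)

proposition15 : ∀ {c ℓ} (F : Field c ℓ) → FieldOps.CharZero F → (h m : ℕ) → 1 ≤ h → 1 ≤ m → m ≤ h
                  → (ω : Field.Carrier F) → FieldOps.IsPrimitiveRoot F h ω
                  → let open Field F in
                    let open FieldOps F in
                    divisorSumL h ω m ≈ fromℕ m - fromℕ (h Data.Nat.+ 1) * (fromℕ 2 ⁻¹)
proposition15 F charZero (suc n) (suc m) _ _ m<h ω prim = begin
  divisorSumL (suc n) ω (suc m)
    ≈⟨ divisorSumL≈ (suc m) ⟩
  ∑< n (λ i → geometricTail (suc m) (ω ^ suc i))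
    ≈⟨ ∑<-geometricTails m m<h ⟩
  reciprocalSum - (fromℕ n - fromℕ m)
    ≈⟨ n/2-[n-m]≈[m+1]-[n+2]/2 n m reciprocalSum-doubled ⟩
  fromℕ (suc m) - fromℕ (suc n Data.Nat.+ 1) * ½ ∎
  where
    open Field F
    open FieldOps F
    open FieldFacts F
    open Halving (charZero 1)
    open PrimitiveRoot F prim
    open import Relation.Binary.Reasoning.Setoid setoid
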